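{- Let $G_1,G_2$ be graphs each containing a clique of order $k$, with independence numbers $\beta_0(G_1),\beta_0(G_2)$, and let $G=G_1\circ_k G_2$. Then $\beta_0(G_1)+\beta_0(G_2)-2\le \beta_0(G)\le \beta_0(G_1)+\beta_0(G_2)$.
   Context: All graphs are finite and simple. For graphs $G_1,G_2$ each containing a clique of order $k$, the $k$-coalescence $G_1\circ_k G_2$ is obtained by choosing a $k$-clique in each graph and identifying these two cliques vertex by vertex. The independence number $\beta_0(G)$ is the maximum size of a set of pairwise non-adjacent vertices. -}

module Defs where

open import Level using (0ℓ)
open import Data.Nat using (ℕ; _≤_)
open import Data.Fin using (Fin; _≟_)
open import Data.Bool using (Bool; not; T)
open import Data.List using (List; length; allFin)
open import Data.Bool.ListAction using (any)
open import Data.Product using (Σ; ∃; _×_; _,_)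
open import Data.Sum using (_⊎_; inj₁; inj₂)
open import Data.List.Relation.Unary.AllPairs using (AllPairs)
open import Data.List.Relation.Unary.Unique.Propositional using (Unique)
open import Relation.Nullary using (¬_; ⌊_⌋)
open import Relation.Binary.PropositionalEquality using (_≡_; _≢_)

record Graph (n : ℕ) : Set₁ where
  field
    Adj    : Fin n → Fin n → Set
    sym    : ∀ {u v} → Adj u v → Adj v u
    irrefl : ∀ {v} → ¬ Adj v v
open Graph public

record Clique {n : ℕ} (G : Graph n) (k : ℕ) : Set where
  field
    vertex    : Fin k → Fin n
    injective : ∀ {i j} → vertex i ≡ vertex j → i ≡ j
    adjacent  : ∀ {i j} → i ≢ j → Adj G (vertex i) (vertex j)
open Clique public

Independent : {V : Set} → (V → V → Set) → List V → Set
Independent E xs = Unique xs × AllPairs (λ x y → ¬ E x y) xs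

IsIndependenceNumber : {V : Set} → (V → V → Set) → ℕ → Set
IsIndependenceNumber {V} E b =
  (∃ λ (xs : List V) → Independent E xs × length xs ≡ b)
  × (∀ (xs : List V) → Independent E xs → length xs ≤ b)

inClique : ∀ {n k} {G : Graph n} → Clique G k → Fin n → Bool
inClique {k = k} c v = any (λ i → ⌊ vertex c i ≟ v ⌋) (allFin k)

-- Vertex set of the k-coalescence G₁ ∘ₖ G₂: all vertices of G₁, together with
-- the vertices of G₂ that are not on the chosen clique (the clique vertices of G₂
-- are identified with those of G₁: vertex c₂ i ↦ vertex c₁ i).
CoalVertex : ∀ {n₁ n₂ k} {G₁ : Graph n₁} {G₂ : Graph n₂} →
             Clique G₁ k → Clique G₂ k → Set
CoalVertex {n₁} {n₂} c₁ c₂ = Fin n₁ ⊎ Σ (Fin n₂) (λ v → T (not (inClique c₂ v)))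

CoalAdj : ∀ {n₁ n₂ k} {G₁ : Graph n₁} {G₂ : Graph n₂} →
          (c₁ : Clique G₁ k) (c₂ : Clique G₂ k) →
          CoalVertex c₁ c₂ → CoalVertex c₁ c₂ → Set
CoalAdj {G₁ = G₁} c₁ c₂ (inj₁ a) (inj₁ b) = Adj G₁ a b
CoalAdj {G₂ = G₂} c₁ c₂ (inj₂ (u , _)) (inj₂ (v , _)) = Adj G₂ u v
CoalAdj {k = k} {G₂ = G₂} c₁ c₂ (inj₁ a) (inj₂ (v , _)) =
  ∃ λ (i : Fin k) → vertex c₁ i ≡ a × Adj G₂ (vertex c₂ i) v
CoalAdj {k = k} {G₂ = G₂} c₁ c₂ (inj₂ (u , _)) (inj₁ b) =
  ∃ λ (i : Fin k) → vertex c₁ i ≡ b × Adj G₂ u (vertex c₂ i)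

{-# OPTIONS --safe #-}
module Submission where

-- An independent set S of G₁ ∘ₖ G₂ splits into its G₁-part and its part outside the clique
-- of G₂, both independent, so β ≤ β₁ + β₂. Conversely, an independent set meets a clique in
-- at most one vertex; deleting the clique vertices from maximum independent sets of G₁ and G₂
-- leaves two sets that no edge of the coalescence joins, since every edge between the two
-- sides has an endpoint on the identified clique. Their union has size at least β₁ + β₂ − 2.

open import Defs hiding (sym)
open import Data.Nat using (ℕ; suc; _+_; _∸_; _≤_; z≤n; s≤s)
open import Data.Nat.Properties
  using (≤-reflexive; ≤-trans; +-mono-≤; +-monoʳ-≤; +-suc; m≤n+o⇒m∸n≤o; module ≤-Reasoning)
open import Data.Bool using (Bool; true; false; not; T)
open import Data.Bool.Properties using (T?; T-irrelevant)
open import Data.Unit using (tt)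
open import Data.Empty using (⊥-elim)
open import Data.Fin using (Fin)
open import Data.List using (List; []; _∷_; _++_; map; filter; length; allFin)
open import Data.List.Properties using (length-map; length-++; filter-all)
open import Data.List.Membership.Propositional using (_∈_)
open import Data.List.Membership.Propositional.Properties using (∈-allFin; ∈-map⁻; ∈-filter⁻)
open import Data.List.Relation.Unary.All as All using (All; []; _∷_)
open import Data.List.Relation.Unary.All.Properties using (all-filter)
import Data.List.Relation.Unary.Any as Any
open import Data.List.Relation.Unary.Any.Properties using (any⁺; any⁻)
open import Data.List.Relation.Unary.AllPairs as AllPairs using (AllPairs; []; _∷_)
import Data.List.Relation.Unary.AllPairs.Properties as AllPairs
open import Data.Product using (Σ; ∃; ∃₂; _×_; _,_; proj₁; proj₂)
open import Data.Sum using (_⊎_; inj₁; inj₂)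
open import Data.Sum.Properties using (inj₁-injective; inj₂-injective)
open import Function using (_∘_; _on_)
open import Relation.Nullary using (¬_; yes; no; toWitness; fromWitness)
open import Relation.Unary using (Decidable)
open import Relation.Binary.PropositionalEquality using (_≡_; _≢_; refl; sym; trans; cong; cong₂; subst)

private
  variable
    A B : Set
    E : A → A → Set

T-not⇒¬T : ∀ {b} → T (not b) → ¬ T b
T-not⇒¬T {true} ()

¬T-not⇒T : ∀ {b} → ¬ T (not b) → T b
¬T-not⇒T {true}  _   = tt
¬T-not⇒T {false} ¬tt = ¬tt tt

proj₁-injective : ∀ {p : A → Bool} {u v : Σ A (T ∘ p)} → proj₁ u ≡ proj₁ v → u ≡ v
proj₁-injective {u = x , s} {v = .x , t} refl = cong (x ,_) (T-irrelevant s t)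

length≤suc-length-filter : ∀ {P : A → Set} (P? : Decidable P) {xs : List A} →
                           AllPairs (λ x y → P x ⊎ P y) xs →
                           length xs ≤ suc (length (filter P? xs))
length≤suc-length-filter P? {[]}     []          = z≤n
length≤suc-length-filter {P = P} P? {x ∷ xs} (Px⊎Py ∷ pairs) with P? x
... | yes _  = s≤s (length≤suc-length-filter P? pairs)
... | no ¬Px = s≤s (≤-reflexive (cong length (sym (filter-all P? (All.map onlyRight Px⊎Py)))))
  where
  onlyRight : ∀ {y} → P x ⊎ P y → P y
  onlyRight (inj₁ Px) = ⊥-elim (¬Px Px)
  onlyRight (inj₂ Py) = Py

map-proj₁-toList : ∀ {P : A → Set} {xs : List A} (pxs : All P xs) → map proj₁ (All.toList pxs) ≡ xs
map-proj₁-toList []         = refl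
map-proj₁-toList (px ∷ pxs) = cong (_ ∷_) (map-proj₁-toList pxs)

lefts : List (A ⊎ B) → List A
lefts []            = []
lefts (inj₁ x ∷ xs) = x ∷ lefts xs
lefts (inj₂ _ ∷ xs) = lefts xs

rights : List (A ⊎ B) → List B
rights []            = []
rights (inj₁ _ ∷ xs) = rights xs
rights (inj₂ y ∷ xs) = y ∷ rights xs

length-lefts+rights : (xs : List (A ⊎ B)) → length (lefts xs) + length (rights xs) ≡ length xs
length-lefts+rights []            = refl
length-lefts+rights (inj₁ _ ∷ xs) = cong suc (length-lefts+rights xs)
length-lefts+rights (inj₂ _ ∷ xs) = trans (+-suc _ _) (cong suc (length-lefts+rights xs))

All-lefts : ∀ {P : A ⊎ B → Set} {xs} → All P xs → All (P ∘ inj₁) (lefts xs)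
All-lefts {xs = []}          []         = []
All-lefts {xs = inj₁ _ ∷ xs} (px ∷ pxs) = px ∷ All-lefts pxs
All-lefts {xs = inj₂ _ ∷ xs} (_  ∷ pxs) = All-lefts pxs

All-rights : ∀ {P : A ⊎ B → Set} {xs} → All P xs → All (P ∘ inj₂) (rights xs)
All-rights {xs = []}          []         = []
All-rights {xs = inj₁ _ ∷ xs} (_  ∷ pxs) = All-rights pxs
All-rights {xs = inj₂ _ ∷ xs} (px ∷ pxs) = px ∷ All-rights pxs

AllPairs-lefts : ∀ {R : A ⊎ B → A ⊎ B → Set} {xs} → AllPairs R xs → AllPairs (R on inj₁) (lefts xs)
AllPairs-lefts {xs = []}          []           = []
AllPairs-lefts {xs = inj₁ _ ∷ xs} (px ∷ pairs) = All-lefts px ∷ AllPairs-lefts pairs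
AllPairs-lefts {xs = inj₂ _ ∷ xs} (_  ∷ pairs) = AllPairs-lefts pairs

AllPairs-rights : ∀ {R : A ⊎ B → A ⊎ B → Set} {xs} → AllPairs R xs → AllPairs (R on inj₂) (rights xs)
AllPairs-rights {xs = []}          []           = []
AllPairs-rights {xs = inj₁ _ ∷ xs} (_  ∷ pairs) = AllPairs-rights pairs
AllPairs-rights {xs = inj₂ _ ∷ xs} (px ∷ pairs) = All-rights px ∷ AllPairs-rights pairs

NonAdjacent : (A → A → Set) → A → A → Set
NonAdjacent E x y = x ≢ y × ¬ E x y

independent⁺ : ∀ {xs} → AllPairs (NonAdjacent E) xs → Independent E xs
independent⁺ = AllPairs.unzip

independent⁻ : ∀ {xs} → Independent E xs → AllPairs (NonAdjacent E) xs
independent⁻ = AllPairs.zip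

independent-map⁺ : ∀ {E′ : B → B → Set} {f : A → B} →
                   (∀ {x y} → NonAdjacent E x y → NonAdjacent E′ (f x) (f y)) →
                   ∀ {xs} → Independent E xs → Independent E′ (map f xs)
independent-map⁺ pres ind = independent⁺ (AllPairs.map⁺ (AllPairs.map pres (independent⁻ ind)))

independent-map⁻ : ∀ {f : B → A} {xs} → Independent E (map f xs) → Independent (E on f) xs
independent-map⁻ {f = f} ind =
  independent⁺ (AllPairs.map (λ (≢ , ¬E) → ≢ ∘ cong f , ¬E) (AllPairs.map⁻ (independent⁻ ind)))

independent-filter : ∀ {P : A → Set} (P? : Decidable P) {xs} →
                     Independent E xs → Independent E (filter P? xs)
independent-filter P? ind = independent⁺ (AllPairs.filter⁺ P? (independent⁻ ind))

independent-++ : ∀ {xs ys} → Independent E xs → Independent E ys →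
                 (∀ {x y} → x ∈ xs → y ∈ ys → NonAdjacent E x y) →
                 Independent E (xs ++ ys)
independent-++ ixs iys cross =
  independent⁺ (AllPairs.++⁺ (independent⁻ ixs) (independent⁻ iys)
                              (All.tabulate λ x∈ → All.tabulate λ y∈ → cross x∈ y∈))

independent-lefts : ∀ {E : A ⊎ B → A ⊎ B → Set} {xs} →
                    Independent E xs → Independent (E on inj₁) (lefts xs)
independent-lefts ind =
  independent⁺ (AllPairs.map (λ (≢ , ¬E) → ≢ ∘ cong inj₁ , ¬E) (AllPairs-lefts (independent⁻ ind)))

independent-rights : ∀ {E : A ⊎ B → A ⊎ B → Set} {xs} →
                     Independent E xs → Independent (E on inj₂) (rights xs)
independent-rights ind =
  independent⁺ (AllPairs.map (λ (≢ , ¬E) → ≢ ∘ cong inj₂ , ¬E) (AllPairs-rights (independent⁻ ind)))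

module _ {n k : ℕ} {G : Graph n} (c : Clique G k) where

  OnClique : Fin n → Set
  OnClique v = ∃ λ i → vertex c i ≡ v

  OffClique : Fin n → Set
  OffClique v = T (not (inClique c v))

  offClique? : Decidable OffClique
  offClique? v = T? (not (inClique c v))

  inClique⁺ : ∀ {v} → OnClique v → T (inClique c v)
  inClique⁺ (i , refl) = any⁺ _ (Any.map (λ { refl → fromWitness refl }) (∈-allFin i))

  inClique⁻ : ∀ {v} → T (inClique c v) → OnClique v
  inClique⁻ t = let (i , eq) = Any.satisfied (any⁻ _ (allFin k) t) in i , toWitness eq

  offClique⇒¬onClique : ∀ {v} → OffClique v → ¬ OnClique v
  offClique⇒¬onClique off = T-not⇒¬T off ∘ inClique⁺

  nonAdjacent⇒offClique : ∀ {u v} → NonAdjacent (Adj G) u v → OffClique u ⊎ OffClique v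
  nonAdjacent⇒offClique {u} {v} (u≢v , ¬adj) with offClique? u | offClique? v
  ... | yes off-u | _         = inj₁ off-u
  ... | no _      | yes off-v = inj₂ off-v
  ... | no on-u   | no on-v   with inClique⁻ (¬T-not⇒T on-u) | inClique⁻ (¬T-not⇒T on-v)
  ...   | i , refl | j , refl = ⊥-elim (¬adj (adjacent c (u≢v ∘ cong (vertex c))))

  length≤suc-length-offClique : ∀ {xs} → Independent (Adj G) xs →
                                length xs ≤ suc (length (filter offClique? xs))
  length≤suc-length-offClique ind =
    length≤suc-length-filter offClique? (AllPairs.map nonAdjacent⇒offClique (independent⁻ ind))

module _ {n₁ n₂ k : ℕ} {G₁ : Graph n₁} {G₂ : Graph n₂} (c₁ : Clique G₁ k) (c₂ : Clique G₂ k) where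

  coalescence-split : ∀ {S} → Independent (CoalAdj c₁ c₂) S →
                      ∃₂ λ I₁ I₂ → Independent (Adj G₁) I₁ × Independent (Adj G₂) I₂ ×
                                   length I₁ + length I₂ ≡ length S
  coalescence-split {S} ind =
      lefts S , map proj₁ (rights S)
    , independent-lefts ind
    , independent-map⁺ (λ (≢ , ¬adj) → ≢ ∘ proj₁-injective , ¬adj) (independent-rights ind)
    , trans (cong (length (lefts S) +_) (length-map proj₁ (rights S))) (length-lefts+rights S)

  coalescence-merge : ∀ {I₁ I₂} → Independent (Adj G₁) I₁ → Independent (Adj G₂) I₂ →
                      ∃ λ S → Independent (CoalAdj c₁ c₂) S × length I₁ + length I₂ ≤ 2 + length S
  coalescence-merge {I₁} {I₂} ind₁ ind₂ = S , independent-S , size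
    where
    L₁ = filter (offClique? c₁) I₁
    L₂ = filter (offClique? c₂) I₂
    off₂ = all-filter (offClique? c₂) I₂
    R₂ = All.toList off₂
    S = map inj₁ L₁ ++ map inj₂ R₂

    independent-R₂ : Independent (Adj G₂ on proj₁) R₂
    independent-R₂ = independent-map⁻ (subst (Independent (Adj G₂)) (sym (map-proj₁-toList off₂))
                                              (independent-filter (offClique? c₂) ind₂))

    cross : ∀ {x y} → x ∈ map inj₁ L₁ → y ∈ map inj₂ R₂ → NonAdjacent (CoalAdj c₁ c₂) x y
    cross x∈ y∈ with ∈-map⁻ inj₁ x∈ | ∈-map⁻ inj₂ y∈
    ... | a , a∈L₁ , refl | _ , _ , refl =
      let off-a = proj₂ (∈-filter⁻ (offClique? c₁) {xs = I₁} a∈L₁) in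
      (λ ()) , λ (i , eq , _) → offClique⇒¬onClique c₁ off-a (i , eq)

    independent-S : Independent (CoalAdj c₁ c₂) S
    independent-S = independent-++
      (independent-map⁺ (λ (≢ , ¬adj) → ≢ ∘ inj₁-injective , ¬adj)
                        (independent-filter (offClique? c₁) ind₁))
      (independent-map⁺ (λ (≢ , ¬adj) → ≢ ∘ inj₂-injective , ¬adj) independent-R₂)
      cross

    size : length I₁ + length I₂ ≤ 2 + length S
    size = begin
      length I₁ + length I₂              ≤⟨ +-mono-≤ (length≤suc-length-offClique c₁ ind₁)
                                                     (length≤suc-length-offClique c₂ ind₂) ⟩
      suc (length L₁) + suc (length L₂)  ≡⟨ cong suc (+-suc (length L₁) (length L₂)) ⟩
      2 + (length L₁ + length L₂)        ≡⟨ cong (λ m → 2 + (length L₁ + m)) length-L₂ ⟩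
      2 + (length L₁ + length R₂)        ≡⟨ cong (2 +_) (sym length-S) ⟩
      2 + length S                       ∎
      where
      open ≤-Reasoning
      length-L₂ : length L₂ ≡ length R₂
      length-L₂ = trans (cong length (sym (map-proj₁-toList off₂))) (length-map proj₁ R₂)
      length-S : length S ≡ length L₁ + length R₂
      length-S = trans (length-++ (map inj₁ L₁))
                       (cong₂ _+_ (length-map inj₁ L₁) (length-map inj₂ R₂))

mainTheorem8 : ∀ {n₁ n₂ k : ℕ} (G₁ : Graph n₁) (G₂ : Graph n₂)
                 (c₁ : Clique G₁ k) (c₂ : Clique G₂ k) (β₁ β₂ β : ℕ) →
                 IsIndependenceNumber (Adj G₁) β₁ →
                 IsIndependenceNumber (Adj G₂) β₂ →
                 IsIndependenceNumber (CoalAdj c₁ c₂) β →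
                 (β₁ + β₂ ∸ 2 ≤ β) × (β ≤ β₁ + β₂)
mainTheorem8 G₁ G₂ c₁ c₂ _ _ _
  ((I₁ , ind₁ , refl) , max₁) ((I₂ , ind₂ , refl) , max₂) ((S , ind , refl) , max) =
  lower , upper
  where
  lower : length I₁ + length I₂ ∸ 2 ≤ length S
  lower = let (T , indT , size) = coalescence-merge c₁ c₂ ind₁ ind₂ in
    m≤n+o⇒m∸n≤o _ 2 (≤-trans size (+-monoʳ-≤ 2 (max T indT)))

  upper : length S ≤ length I₁ + length I₂
  upper = let (J₁ , J₂ , indJ₁ , indJ₂ , size) = coalescence-split c₁ c₂ ind in
    subst (_≤ length I₁ + length I₂) size (+-mono-≤ (max₁ J₁ indJ₁) (max₂ J₂ indJ₂))
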